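{- For $n\ge 1$, the complete graph $K_n$ satisfies $\nu_*(K_n)=\frac{(n-1)n(n+1)(n+4)}{12}$.
   Context: For a finite simple graph $G=(V,E)$ with $p=|V|$, $q=|E|$, $\ell=p+q$, a construction sequence (c-sequence) for $G$ is a bijection $x:\{1,\dots,\ell\}\to V\sqcup E$ such that for every edge $e=uw$, $x^{ -1}(e)>\max\{x^{ -1}(u),x^{ -1}(w)\}$. The cost of an edge $e=uw$ in $x$ is $\nu(e,x)=(x^{ -1}(e)-x^{ -1}(u))+(x^{ -1}(e)-x^{ -1}(w))$, and the cost of $x$ is $\nu(x)=\sum_{e\in E}\nu(e,x)$. The min cost of $G$ is $\nu_*(G)=\min\nu(x)$ over all c-sequences $x$ for $G$. -}

module Defs where

open import Data.Nat using (ℕ; _+_; _*_; _∸_; _<_; _≤_)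
open import Data.Nat.ListAction using (sum)
open import Data.Fin using (Fin; toℕ)
open import Data.List using (map; allFin)
open import Data.Product using (Σ-syntax; _×_; _,_; proj₁; proj₂)
open import Data.Sum using (_⊎_; inj₁; inj₂)
open import Function.Bundles using (_↔_; Inverse)
open import Relation.Binary.PropositionalEquality using (_≡_; _≢_; refl; cong)
open import Data.Nat.Properties using (<-irrefl; <-asym; <-irrelevant)
open import Data.Empty using (⊥-elim)

-- A simple graph: vertex type V, edge type E, each edge has two distinct
-- endpoints, distinct edges have distinct unordered endpoint pairs.
-- (Finiteness is enforced by the existence of a c-sequence, which is a
-- bijection Fin ℓ ↔ V ⊎ E; see below.)
record Graph : Set₁ where
  field
    V E      : Set
    ends     : E → V × V
    loopless : ∀ e → proj₁ (ends e) ≢ proj₂ (ends e)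
    simple   : ∀ e f → (ends e ≡ ends f ⊎ ends e ≡ (proj₂ (ends f) , proj₁ (ends f))) → e ≡ f

module _ (G : Graph) where
  open Graph G

  -- A construction sequence of length ℓ: a bijection x : {1..ℓ} → V ⊔ E
  -- (positions indexed from 0 via Fin ℓ; costs are differences, so the shift
  -- is irrelevant) such that every edge comes after both its endpoints.
  record CSeq (ℓ : ℕ) : Set where
    field
      x : Fin ℓ ↔ (V ⊎ E)
    pos : V ⊎ E → ℕ
    pos a = toℕ (Inverse.from x a)
    field
      valid : ∀ e → pos (inj₁ (proj₁ (ends e))) < pos (inj₂ e)
                  × pos (inj₁ (proj₂ (ends e))) < pos (inj₂ e)

  edgeCost : ∀ {ℓ} → CSeq ℓ → E → ℕ
  edgeCost s e = (pos (inj₂ e) ∸ pos (inj₁ (proj₁ (ends e))))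
               + (pos (inj₂ e) ∸ pos (inj₁ (proj₂ (ends e))))
    where open CSeq s

  posCost : ∀ {ℓ} → CSeq ℓ → V ⊎ E → ℕ
  posCost s (inj₁ _) = 0
  posCost s (inj₂ e) = edgeCost s e

  -- ν(x) = Σ_{e ∈ E} ν(e,x), computed as a sum over the positions 1..ℓ
  cost : ∀ {ℓ} → CSeq ℓ → ℕ
  cost {ℓ} s = sum (map (λ k → posCost s (Inverse.to (CSeq.x s) k)) (allFin ℓ))

  MinCost : ℕ → Set
  MinCost m = (Σ[ ℓ ∈ ℕ ] Σ[ s ∈ CSeq ℓ ] cost s ≡ m)
            × (∀ ℓ (s : CSeq ℓ) → m ≤ cost s)

KEdge : ℕ → Set
KEdge n = Σ[ i ∈ Fin n ] Σ[ j ∈ Fin n ] toℕ i < toℕ j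

K-loopless : ∀ {n} (e : KEdge n) → proj₁ e ≢ proj₁ (proj₂ e)
K-loopless (i , j , i<j) refl = <-irrefl refl i<j

K-simple : ∀ {n} (e f : KEdge n)
         → ((proj₁ e , proj₁ (proj₂ e)) ≡ (proj₁ f , proj₁ (proj₂ f))
            ⊎ (proj₁ e , proj₁ (proj₂ e)) ≡ (proj₁ (proj₂ f) , proj₁ f))
         → e ≡ f
K-simple (i , j , p) (.i , .j , q) (inj₁ refl) = cong (λ r → i , j , r) (<-irrelevant p q)
K-simple (i , j , p) (.j , .i , q) (inj₂ refl) = ⊥-elim (<-asym p q)

K : ℕ → Graph
K n = record
  { V = Fin n
  ; E = KEdge n
  ; ends = λ e → (proj₁ e , proj₁ (proj₂ e))
  ; loopless = K-loopless
  ; simple = K-simple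
  }

-- Write pos for the position function of a c-sequence of K_n and ℓ = n(n + 1)/2
-- for its length. Edge ij costs 2 pos ij − pos i − pos j and every vertex lies on
-- n − 1 edges, so
--   ν = 2 Σ_e pos e − (n − 1) Σ_v pos v = 2 (0 + 1 + ⋯ + (ℓ − 1)) − (n + 1) Σ_v pos v,
-- and minimising the cost means maximising the total position of the vertices.
-- If a of the first t + 1 items are vertices, the other items among them are edges
-- between those a vertices, hence t + 1 ≤ a(a + 1)/2. Summed over t, this bounds
-- Σ_v pos v by Σ_{j<n} j(j + 1)/2, which is attained by listing vertex j followed
-- by the edges (0, j), …, (j − 1, j) for j = 0, 1, …, n − 1.
module Submission where

open import Defs
open import Data.Nat using (ℕ; suc; _*_; _+_; _/_; _≤_)
open import Data.Nat using (zero; _<_; _∸_; _⊓_; z≤n; s≤s; z<s; NonZero)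
open import Data.Nat.Properties
open import Data.Nat.Divisibility using (divides-refl)
open import Data.Nat.DivMod using (m*n/n≡m; +-distrib-/-∣ʳ)
import Data.Nat.ListAction as List
open import Data.Nat.Solver using (module +-*-Solver)
open import Data.Fin using (Fin; zero; suc; toℕ; fromℕ; fromℕ<; inject₁; _↑ˡ_; _↑ʳ_)
open import Data.Fin.Properties
  using (toℕ-injective; toℕ-inject₁; toℕ-fromℕ; toℕ-fromℕ<; toℕ<n; +↔⊎; splitAt-↑ˡ; splitAt-↑ʳ; toℕ-↑ˡ; toℕ-↑ʳ)
open import Data.Fin.Relation.Unary.Top using (view; ‵fromℕ; ‵inj₁; view-fromℕ; view-inject₁)
open import Data.Fin.Permutation using (↔⇒≡)
open import Data.List using (tabulate)
open import Data.List.Properties using (map-tabulate)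
open import Data.Product using (_,_; proj₁; proj₂)
open import Data.Sum using (_⊎_; inj₁; inj₂; map₁)
open import Data.Sum.Function.Propositional using (_⊎-↔_)
open import Function using (_∘_; id)
open import Function.Bundles using (_↔_; Inverse; mk↔ₛ′)
open import Function.Construct.Composition using (_↔-∘_)
open import Function.Construct.Identity using (↔-id)
open import Function.Construct.Symmetry using (↔-sym)
open import Relation.Binary.PropositionalEquality
open import Relation.Nullary using (yes; no)
open import Algebra.Properties.CommutativeSemigroup +-commutativeSemigroup using (interchange)
open import Algebra.Properties.Semiring.Sum +-*-semiring
  using (sum; sum-syntax; sum-cong-≗; ∑-distrib-+; ∑-comm; ∑-permute; sum-init-last; sum-replicate-zero; *-distribˡ-sum)
open +-*-Solver

open Inverse using (to; from)

∑-mono-≤ : ∀ {n} {f g : Fin n → ℕ} → (∀ i → f i ≤ g i) → sum f ≤ sum g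
∑-mono-≤ {zero}  f≤g = z≤n
∑-mono-≤ {suc n} f≤g = +-mono-≤ (f≤g zero) (∑-mono-≤ (f≤g ∘ suc))

∑-split : ∀ m n (f : Fin (m + n) → ℕ) → sum f ≡ ∑[ i < m ] f (i ↑ˡ n) + ∑[ j < n ] f (m ↑ʳ j)
∑-split zero    n f = refl
∑-split (suc m) n f = trans (cong (f zero +_) (∑-split m n (f ∘ suc))) (sym (+-assoc (f zero) _ _))

listSum-tabulate : ∀ n (f : Fin n → ℕ) → List.sum (tabulate f) ≡ sum f
listSum-tabulate zero    f = refl
listSum-tabulate (suc n) f = cong (f zero +_) (listSum-tabulate n (f ∘ suc))

tri : ℕ → ℕ
tri zero    = 0
tri (suc n) = tri n + suc n

tri-mono-≤ : ∀ {m n} → m ≤ n → tri m ≤ tri n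
tri-mono-≤ z≤n       = z≤n
tri-mono-≤ (s≤s m≤n) = +-mono-≤ (tri-mono-≤ m≤n) (s≤s m≤n)

tri-+-bit : ∀ a {b} → b ≤ 1 → tri (a + b) ≡ tri a + b * suc a
tri-+-bit a {zero}     _ = trans (cong tri (+-identityʳ a)) (sym (+-identityʳ (tri a)))
tri-+-bit a {suc zero} _ = trans (cong tri (+-comm a 1)) (cong (tri a +_) (sym (+-identityʳ (suc a))))
tri-+-bit a {suc (suc _)} (s≤s ())

2*tri≡n*[1+n] : ∀ n → 2 * tri n ≡ n * suc n
2*tri≡n*[1+n] zero    = refl
2*tri≡n*[1+n] (suc n) = begin
  2 * (tri n + suc n)    ≡⟨ *-distribˡ-+ 2 (tri n) (suc n) ⟩
  2 * tri n + 2 * suc n  ≡⟨ cong (_+ 2 * suc n) (2*tri≡n*[1+n] n) ⟩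
  n * suc n + 2 * suc n  ≡⟨ *-distribʳ-+ (suc n) n 2 ⟨
  (n + 2) * suc n        ≡⟨ *-comm (n + 2) (suc n) ⟩
  suc n * (n + 2)        ≡⟨ cong (suc n *_) (+-comm n 2) ⟩
  suc n * suc (suc n)    ∎
  where open ≡-Reasoning

tetra : ℕ → ℕ
tetra n = ∑[ j < n ] tri (toℕ j)

tetra-suc : ∀ n → tetra (suc n) ≡ tetra n + tri n
tetra-suc n = trans (sum-init-last {n} (tri ∘ toℕ))
  (cong₂ _+_ (sum-cong-≗ {n} (cong tri ∘ toℕ-inject₁)) (cong tri (toℕ-fromℕ n)))

6*tetra[1+n] : ∀ n → 6 * tetra (suc n) ≡ n * suc n * (2 + n)
6*tetra[1+n] zero    = refl
6*tetra[1+n] (suc n) = begin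
  6 * tetra (suc (suc n))                          ≡⟨ cong (6 *_) (tetra-suc (suc n)) ⟩
  6 * (tetra (suc n) + tri (suc n))                ≡⟨ solve 2 (λ a b → con 6 :* (a :+ b) := con 6 :* a :+ con 3 :* (con 2 :* b))
                                                       refl (tetra (suc n)) (tri (suc n)) ⟩
  6 * tetra (suc n) + 3 * (2 * tri (suc n))        ≡⟨ cong₂ (λ a b → a + 3 * b) (6*tetra[1+n] n) (2*tri≡n*[1+n] (suc n)) ⟩
  n * suc n * (2 + n) + 3 * (suc n * suc (suc n))  ≡⟨ solve 1 (λ n → n :* (con 1 :+ n) :* (con 2 :+ n)
                                                        :+ con 3 :* ((con 1 :+ n) :* (con 2 :+ n))
                                                     := (con 1 :+ n) :* (con 2 :+ n) :* (con 3 :+ n)) refl n ⟩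
  suc n * suc (suc n) * (2 + suc n)                ∎
  where open ≡-Reasoning

2*∑toℕ+n≡n*n : ∀ n → 2 * ∑[ k < n ] toℕ k + n ≡ n * n
2*∑toℕ+n≡n*n zero    = refl
2*∑toℕ+n≡n*n (suc n) = begin
  2 * ∑[ k < suc n ] toℕ k + suc n    ≡⟨ cong (λ s → 2 * s + suc n) ∑toℕ-last ⟩
  2 * (S + n) + suc n                 ≡⟨ solve 2 (λ s n → con 2 :* (s :+ n) :+ (con 1 :+ n)
                                                   := (con 2 :* s :+ n) :+ (con 1 :+ con 2 :* n)) refl S n ⟩
  (2 * S + n) + (1 + 2 * n)           ≡⟨ cong (_+ (1 + 2 * n)) (2*∑toℕ+n≡n*n n) ⟩
  n * n + (1 + 2 * n)                 ≡⟨ solve 1 (λ n → n :* n :+ (con 1 :+ con 2 :* n)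
                                                   := (con 1 :+ n) :* (con 1 :+ n)) refl n ⟩
  suc n * suc n                       ∎
  where
  open ≡-Reasoning
  S = ∑[ k < n ] toℕ k
  ∑toℕ-last : ∑[ k < suc n ] toℕ k ≡ S + n
  ∑toℕ-last = trans (sum-init-last {n} toℕ) (cong₂ _+_ (sum-cong-≗ {n} toℕ-inject₁) (toℕ-fromℕ n))

m+k*n≡l*n⇒m/n+k≡l : ∀ {n} .{{_ : NonZero n}} m k l → m + k * n ≡ l * n → m / n + k ≡ l
m+k*n≡l*n⇒m/n+k≡l {n} m k l eq = begin
  m / n + k          ≡⟨ cong (m / n +_) (m*n/n≡m k n) ⟨
  m / n + k * n / n  ≡⟨ +-distrib-/-∣ʳ m (divides-refl k) ⟨
  (m + k * n) / n    ≡⟨ cong (_/ n) eq ⟩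
  l * n / n          ≡⟨ m*n/n≡m l n ⟩
  l                  ∎
  where open ≡-Reasoning

minCost-closedForm : ∀ n →
  ((n ∸ 1) * n * (n + 1) * (n + 4)) / 12 + suc n * tetra n ≡ 2 * ∑[ k < tri n ] toℕ k
minCost-closedForm zero    = refl
minCost-closedForm (suc k) = m+k*n≡l*n⇒m/n+k≡l X Y (2 * R) (+-cancelʳ-≡ (N * 12) _ _ (begin
    X + Y * 12 + N * 12                                  ≡⟨ solve 4 (λ x m t n → x :+ m :* t :* con 12 :+ n :* con 12
                                                              := x :+ con 2 :* m :* (con 6 :* t) :+ con 6 :* (con 2 :* n))
                                                            refl X (suc n) (tetra n) N ⟩
    X + 2 * suc n * (6 * tetra n) + 6 * (2 * N)          ≡⟨ cong₂ (λ a b → X + 2 * suc n * a + 6 * b)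
                                                              (6*tetra[1+n] k) (2*tri≡n*[1+n] n) ⟩
    X + 2 * suc n * (k * n * (2 + k)) + 6 * (n * suc n)  ≡⟨ solve 1 (λ k →
          k :* (con 1 :+ k) :* (con 1 :+ k :+ con 1) :* (con 1 :+ k :+ con 4)
            :+ con 2 :* (con 2 :+ k) :* (k :* (con 1 :+ k) :* (con 2 :+ k))
            :+ con 6 :* ((con 1 :+ k) :* (con 2 :+ k))
       := con 3 :* (((con 1 :+ k) :* (con 2 :+ k)) :* ((con 1 :+ k) :* (con 2 :+ k)))) refl k ⟩
    3 * (n * suc n * (n * suc n))                        ≡⟨ cong (λ m → 3 * (m * m)) (2*tri≡n*[1+n] n) ⟨
    3 * (2 * N * (2 * N))                                ≡⟨ solve 1 (λ n → con 3 :* (con 2 :* n :* (con 2 :* n))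
                                                              := n :* n :* con 12) refl N ⟩
    N * N * 12                                           ≡⟨ cong (_* 12) (2*∑toℕ+n≡n*n N) ⟨
    (2 * R + N) * 12                                     ≡⟨ *-distribʳ-+ 12 (2 * R) N ⟩
    2 * R * 12 + N * 12                                  ∎))
  where
  open ≡-Reasoning
  n = suc k
  N = tri n
  R = ∑[ j < N ] toℕ j
  X = k * n * (n + 1) * (n + 4)
  Y = suc n * tetra n

𝟙[_≤_] : ℕ → ℕ → ℕ
𝟙[ zero  ≤ t     ] = 1
𝟙[ suc p ≤ zero  ] = 0
𝟙[ suc p ≤ suc t ] = 𝟙[ p ≤ t ]

𝟙≤1 : ∀ p t → 𝟙[ p ≤ t ] ≤ 1
𝟙≤1 zero    t       = ≤-refl
𝟙≤1 (suc p) zero    = z≤n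
𝟙≤1 (suc p) (suc t) = 𝟙≤1 p t

𝟙-true : ∀ {p t} → p ≤ t → 𝟙[ p ≤ t ] ≡ 1
𝟙-true z≤n       = refl
𝟙-true (s≤s p≤t) = 𝟙-true p≤t

𝟙-false : ∀ {p t} → t < p → 𝟙[ p ≤ t ] ≡ 0
𝟙-false {suc p} {zero}  _         = refl
𝟙-false {suc p} {suc t} (s≤s t<p) = 𝟙-false t<p

𝟙-complement : ∀ p t → 𝟙[ p ≤ t ] + 𝟙[ suc t ≤ p ] ≡ 1
𝟙-complement zero    t       = refl
𝟙-complement (suc p) zero    = refl
𝟙-complement (suc p) (suc t) = 𝟙-complement p t

𝟙≤𝟙*𝟙 : ∀ {u w e} t → u < e → w < e → 𝟙[ e ≤ t ] ≤ 𝟙[ u ≤ t ] * 𝟙[ w ≤ t ]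
𝟙≤𝟙*𝟙 {u} {w} {e} t u<e w<e with e ≤? t
... | yes e≤t rewrite 𝟙-true (<⇒≤ (<-≤-trans u<e e≤t)) | 𝟙-true (<⇒≤ (<-≤-trans w<e e≤t)) = 𝟙≤1 e t
... | no  e≰t rewrite 𝟙-false (≰⇒> e≰t) = z≤n

𝟙[tri≤]≤𝟙[<] : ∀ {t a} j → t < tri a → 𝟙[ tri j ≤ t ] ≤ 𝟙[ suc j ≤ a ]
𝟙[tri≤]≤𝟙[<] {t} {a} j t<tri[a] with suc j ≤? a
... | yes j<a rewrite 𝟙-true j<a = 𝟙≤1 (tri j) t
... | no  j≮a rewrite 𝟙-false (<-≤-trans t<tri[a] (tri-mono-≤ (≮⇒≥ j≮a))) = z≤n

∑𝟙[<]≡⊓ : ∀ n p → ∑[ k < n ] 𝟙[ suc (toℕ k) ≤ p ] ≡ n ⊓ p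
∑𝟙[<]≡⊓ zero    p       = refl
∑𝟙[<]≡⊓ (suc n) zero    = sum-replicate-zero n
∑𝟙[<]≡⊓ (suc n) (suc p) = cong suc (∑𝟙[<]≡⊓ n p)

∑𝟙[≤]≡⊓ : ∀ n t → ∑[ k < n ] 𝟙[ toℕ k ≤ t ] ≡ n ⊓ suc t
∑𝟙[≤]≡⊓ zero    t       = refl
∑𝟙[≤]≡⊓ (suc n) zero    = cong suc (trans (sum-replicate-zero n) (sym (⊓-zeroʳ n)))
∑𝟙[≤]≡⊓ (suc n) (suc t) = cong suc (∑𝟙[≤]≡⊓ n t)

Item : ℕ → Set
Item n = Fin n ⊎ KEdge n

KEdge-≡ : ∀ {n} {i i′ j j′ : Fin n} {p p′} → i ≡ i′ → j ≡ j′ → _≡_ {A = KEdge n} (i , j , p) (i′ , j′ , p′)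
KEdge-≡ {i = i} {j = j} {p = p} {p′ = p′} refl refl = cong (λ r → i , j , r) (<-irrelevant p p′)

liftEdge : ∀ {n} → KEdge n → KEdge (suc n)
liftEdge (i , j , i<j) = inject₁ i , inject₁ j , subst₂ _<_ (sym (toℕ-inject₁ i)) (sym (toℕ-inject₁ j)) i<j

edgeToTop : ∀ {n} → Fin n → KEdge (suc n)
edgeToTop {n} i = inject₁ i , fromℕ n , subst₂ _<_ (sym (toℕ-inject₁ i)) (sym (toℕ-fromℕ n)) (toℕ<n i)

module _ {n : ℕ} where

  addTop : Item n ⊎ Fin (suc n) → Item (suc n)
  addTop (inj₁ (inj₁ v))    = inj₁ (inject₁ v)
  addTop (inj₁ (inj₂ e))    = inj₂ (liftEdge e)
  addTop (inj₂ zero)        = inj₁ (fromℕ n)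
  addTop (inj₂ (suc i))     = inj₂ (edgeToTop i)

  removeTop : Item (suc n) → Item n ⊎ Fin (suc n)
  removeTop (inj₁ v) with view v
  ... | ‵fromℕ           = inj₂ zero
  ... | ‵inj₁ {i = v′} _ = inj₁ (inj₁ v′)
  removeTop (inj₂ (i , j , i<j)) with view j
  ... | ‵fromℕ           = inj₂ (suc (fromℕ< (subst (toℕ i <_) (toℕ-fromℕ n) i<j)))
  ... | ‵inj₁ {i = j′} _ = inj₁ (inj₂ (fromℕ< (<-trans i<j′ (toℕ<n j′)) , j′ ,
                                       subst (_< toℕ j′) (sym (toℕ-fromℕ< _)) i<j′))
    where
    i<j′ : toℕ i < toℕ j′
    i<j′ = subst (toℕ i <_) (toℕ-inject₁ j′) i<j

  addTop-removeTop : ∀ y → addTop (removeTop y) ≡ y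
  addTop-removeTop (inj₁ v) with view v
  ... | ‵fromℕ  = refl
  ... | ‵inj₁ _ = refl
  addTop-removeTop (inj₂ (i , j , _)) with view j
  ... | ‵fromℕ  = cong inj₂ (KEdge-≡ (toℕ-injective (trans (toℕ-inject₁ _) (toℕ-fromℕ< _))) refl)
  ... | ‵inj₁ _ = cong inj₂ (KEdge-≡ (toℕ-injective (trans (toℕ-inject₁ _) (toℕ-fromℕ< _))) refl)

  removeTop-addTop : ∀ z → removeTop (addTop z) ≡ z
  removeTop-addTop (inj₁ (inj₁ v)) rewrite view-inject₁ v = refl
  removeTop-addTop (inj₁ (inj₂ (i , j , _))) rewrite view-inject₁ j =
    cong (inj₁ ∘ inj₂) (KEdge-≡ (toℕ-injective (trans (toℕ-fromℕ< _) (toℕ-inject₁ i))) refl)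
  removeTop-addTop (inj₂ zero) rewrite view-fromℕ n = refl
  removeTop-addTop (inj₂ (suc i)) rewrite view-fromℕ n =
    cong (inj₂ ∘ suc) (toℕ-injective (trans (toℕ-fromℕ< _) (toℕ-inject₁ i)))

  addTop↔ : (Item n ⊎ Fin (suc n)) ↔ Item (suc n)
  addTop↔ = mk↔ₛ′ addTop removeTop addTop-removeTop removeTop-addTop

canonical : ∀ n → Fin (tri n) ↔ Item n
canonical zero    = mk↔ₛ′ (λ ()) (λ { (inj₁ ()) ; (inj₂ (() , _)) }) (λ { (inj₁ ()) ; (inj₂ (() , _)) }) (λ ())
canonical (suc n) = addTop↔ ↔-∘ ((canonical n ⊎-↔ ↔-id (Fin (suc n))) ↔-∘ +↔⊎)

canonical-vertexPos : ∀ n (v : Fin n) → toℕ (from (canonical n) (inj₁ v)) ≡ tri (toℕ v)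
canonical-vertexPos (suc n) v with view v
... | ‵fromℕ = begin
  toℕ (tri n ↑ʳ zero)  ≡⟨ toℕ-↑ʳ (tri n) zero ⟩
  tri n + 0            ≡⟨ +-identityʳ (tri n) ⟩
  tri n                ≡⟨ cong tri (toℕ-fromℕ n) ⟨
  tri (toℕ (fromℕ n))  ∎
  where open ≡-Reasoning
... | ‵inj₁ {i = v′} _ = begin
  toℕ (from (canonical n) (inj₁ v′) ↑ˡ suc n)  ≡⟨ toℕ-↑ˡ _ (suc n) ⟩
  toℕ (from (canonical n) (inj₁ v′))           ≡⟨ canonical-vertexPos n v′ ⟩
  tri (toℕ v′)                                 ≡⟨ cong tri (toℕ-inject₁ v′) ⟨
  tri (toℕ (inject₁ v′))                       ∎
  where open ≡-Reasoning

canonical-edgePos : ∀ n (i j : Fin n) (i<j : toℕ i < toℕ j) →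
                    toℕ (from (canonical n) (inj₂ (i , j , i<j))) ≡ tri (toℕ j) + suc (toℕ i)
canonical-edgePos (suc n) i j _ with view j
... | ‵fromℕ = trans (toℕ-↑ʳ (tri n) (suc _))
  (cong₂ (λ a b → tri a + suc b) (sym (toℕ-fromℕ n)) (toℕ-fromℕ< _))
... | ‵inj₁ {i = j′} _ = trans (toℕ-↑ˡ _ (suc n)) (trans (canonical-edgePos n _ j′ _)
  (cong₂ (λ a b → tri a + suc b) (sym (toℕ-inject₁ j′)) (toℕ-fromℕ< _)))

canonicalCSeq : ∀ n → CSeq (K n) (tri n)
canonicalCSeq n = record { x = canonical n ; valid = λ { (i , j , i<j) → i-before i j i<j , j-before i j i<j } }
  where
  j-before : ∀ i j (i<j : toℕ i < toℕ j) →
             toℕ (from (canonical n) (inj₁ j)) < toℕ (from (canonical n) (inj₂ (i , j , i<j)))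
  j-before i j i<j = subst₂ _<_ (sym (canonical-vertexPos n j)) (sym (canonical-edgePos n i j i<j))
    (m<m+n (tri (toℕ j)) z<s)
  i-before : ∀ i j (i<j : toℕ i < toℕ j) →
             toℕ (from (canonical n) (inj₁ i)) < toℕ (from (canonical n) (inj₂ (i , j , i<j)))
  i-before i j i<j = ≤-<-trans
    (subst₂ _≤_ (sym (canonical-vertexPos n i)) (sym (canonical-vertexPos n j)) (tri-mono-≤ (<⇒≤ i<j)))
    (j-before i j i<j)

edgeSum : ∀ n → (KEdge n → ℕ) → ℕ
edgeSum zero    h = 0
edgeSum (suc n) h = edgeSum n (h ∘ liftEdge) + ∑[ i < n ] h (edgeToTop i)

edgeSum-cong : ∀ n {f g : KEdge n → ℕ} → (∀ e → f e ≡ g e) → edgeSum n f ≡ edgeSum n g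
edgeSum-cong zero    f≗g = refl
edgeSum-cong (suc n) f≗g = cong₂ _+_ (edgeSum-cong n (f≗g ∘ liftEdge)) (sum-cong-≗ (f≗g ∘ edgeToTop))

edgeSum-mono-≤ : ∀ n {f g : KEdge n → ℕ} → (∀ e → f e ≤ g e) → edgeSum n f ≤ edgeSum n g
edgeSum-mono-≤ zero    f≤g = z≤n
edgeSum-mono-≤ (suc n) f≤g = +-mono-≤ (edgeSum-mono-≤ n (f≤g ∘ liftEdge)) (∑-mono-≤ (f≤g ∘ edgeToTop))

edgeSum-distrib-+ : ∀ n (f g : KEdge n → ℕ) → edgeSum n (λ e → f e + g e) ≡ edgeSum n f + edgeSum n g
edgeSum-distrib-+ zero    f g = refl
edgeSum-distrib-+ (suc n) f g = trans
  (cong₂ _+_ (edgeSum-distrib-+ n (f ∘ liftEdge) (g ∘ liftEdge)) (∑-distrib-+ (f ∘ edgeToTop) (g ∘ edgeToTop)))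
  (interchange (edgeSum n (f ∘ liftEdge)) _ _ _)

*-distribˡ-edgeSum : ∀ n c (f : KEdge n → ℕ) → c * edgeSum n f ≡ edgeSum n (λ e → c * f e)
*-distribˡ-edgeSum zero    c f = *-zeroʳ c
*-distribˡ-edgeSum (suc n) c f = trans (*-distribˡ-+ c _ _)
  (cong₂ _+_ (*-distribˡ-edgeSum n c (f ∘ liftEdge)) (*-distribˡ-sum c (f ∘ edgeToTop)))

-- Every vertex of K_n lies on n − 1 edges.
edgeSum-endpoints : ∀ n (q : Fin n → ℕ) →
                    edgeSum n (λ e → q (proj₁ e) + q (proj₁ (proj₂ e))) + sum q ≡ n * sum q
edgeSum-endpoints zero    q = refl
edgeSum-endpoints (suc n) q = begin
  E + ∑[ i < n ] (q (inject₁ i) + t) + sum q  ≡⟨ cong₂ (λ a b → E + a + b)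
                                                  (trans (∑-distrib-+ (q ∘ inject₁) (λ _ → t)) (cong (S +_) (∑-const n)))
                                                  (sum-init-last q) ⟩
  E + (S + n * t) + (S + t)                   ≡⟨ solve 4 (λ e s nt t → e :+ (s :+ nt) :+ (s :+ t)
                                                            := (e :+ s) :+ (nt :+ (s :+ t))) refl E S (n * t) t ⟩
  (E + S) + (n * t + (S + t))                 ≡⟨ cong (_+ (n * t + (S + t))) (edgeSum-endpoints n (q ∘ inject₁)) ⟩
  n * S + (n * t + (S + t))                   ≡⟨ solve 3 (λ n s t → n :* s :+ (n :* t :+ (s :+ t))
                                                            := (con 1 :+ n) :* (s :+ t)) refl n S t ⟩
  suc n * (S + t)                             ≡⟨ cong (suc n *_) (sum-init-last q) ⟨
  suc n * sum q                               ∎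
  where
  open ≡-Reasoning
  E = edgeSum n (λ e → q (inject₁ (proj₁ e)) + q (inject₁ (proj₁ (proj₂ e))))
  S = sum (q ∘ inject₁)
  t = q (fromℕ n)
  ∑-const : ∀ m → ∑[ i < m ] t ≡ m * t
  ∑-const zero    = refl
  ∑-const (suc m) = cong (t +_) (∑-const m)

-- For the indicator b of a set of a vertices: the set spans a(a − 1)/2 edges.
edgeSum-inside : ∀ n (b : Fin n → ℕ) → (∀ v → b v ≤ 1) →
                 edgeSum n (λ e → b (proj₁ e) * b (proj₁ (proj₂ e))) + sum b ≡ tri (sum b)
edgeSum-inside zero    b b≤1 = refl
edgeSum-inside (suc n) b b≤1 = begin
  E + ∑[ i < n ] (b (inject₁ i) * t) + sum b  ≡⟨ cong₂ (λ a c → E + a + c)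
                                                  (trans (sum-cong-≗ (λ i → *-comm (b (inject₁ i)) t))
                                                         (sym (*-distribˡ-sum t (b ∘ inject₁))))
                                                  (sum-init-last b) ⟩
  E + t * S + (S + t)                         ≡⟨ solve 3 (λ e t s → e :+ t :* s :+ (s :+ t)
                                                            := (e :+ s) :+ t :* (con 1 :+ s)) refl E t S ⟩
  (E + S) + t * suc S                         ≡⟨ cong (_+ t * suc S) (edgeSum-inside n (b ∘ inject₁) (b≤1 ∘ inject₁)) ⟩
  tri S + t * suc S                           ≡⟨ tri-+-bit S (b≤1 (fromℕ n)) ⟨
  tri (S + t)                                 ≡⟨ cong tri (sum-init-last b) ⟨
  tri (sum b)                                 ∎
  where
  open ≡-Reasoning
  E = edgeSum n (λ e → b (inject₁ (proj₁ e)) * b (inject₁ (proj₁ (proj₂ e))))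
  S = sum (b ∘ inject₁)
  t = b (fromℕ n)

∑-canonical : ∀ n (g : Item n → ℕ) →
              ∑[ k < tri n ] g (to (canonical n) k) ≡ ∑[ v < n ] g (inj₁ v) + edgeSum n (g ∘ inj₂)
∑-canonical zero    g = refl
∑-canonical (suc n) g = begin
  ∑[ k < tri n + suc n ] g (to (canonical (suc n)) k)
    ≡⟨ ∑-split (tri n) (suc n) _ ⟩
  ∑[ k < tri n ] g (to (canonical (suc n)) (k ↑ˡ suc n)) + ∑[ j < suc n ] g (to (canonical (suc n)) (tri n ↑ʳ j))
    ≡⟨ cong₂ _+_ (sum-cong-≗ (λ k → cong (g ∘ addTop ∘ map₁ (to (canonical n))) (splitAt-↑ˡ (tri n) k (suc n))))
                 (sum-cong-≗ (λ j → cong (g ∘ addTop ∘ map₁ (to (canonical n))) (splitAt-↑ʳ (tri n) (suc n) j))) ⟩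
  ∑[ k < tri n ] g (addTop (inj₁ (to (canonical n) k))) + (g (inj₁ (fromℕ n)) + newEdges)
    ≡⟨ cong (_+ (g (inj₁ (fromℕ n)) + newEdges)) (∑-canonical n (g ∘ addTop ∘ inj₁)) ⟩
  (∑[ v < n ] g (inj₁ (inject₁ v)) + edgeSum n (g ∘ inj₂ ∘ liftEdge)) + (g (inj₁ (fromℕ n)) + newEdges)
    ≡⟨ interchange (∑[ v < n ] g (inj₁ (inject₁ v))) _ _ _ ⟩
  (∑[ v < n ] g (inj₁ (inject₁ v)) + g (inj₁ (fromℕ n))) + edgeSum (suc n) (g ∘ inj₂)
    ≡⟨ cong (_+ edgeSum (suc n) (g ∘ inj₂)) (sum-init-last (g ∘ inj₁)) ⟨
  ∑[ v < suc n ] g (inj₁ v) + edgeSum (suc n) (g ∘ inj₂)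
    ∎
  where
  open ≡-Reasoning
  newEdges = ∑[ i < n ] g (inj₂ (edgeToTop i))

module _ {n ℓ : ℕ} (s : CSeq (K n) ℓ) where
  open CSeq s

  vertexPosSum : ℕ
  vertexPosSum = ∑[ v < n ] pos (inj₁ v)

  tri≡length : tri n ≡ ℓ
  tri≡length = ↔⇒≡ (↔-sym x ↔-∘ canonical n)

  ∑-positions : ∀ (g : Item n → ℕ) → ∑[ k < ℓ ] g (to x k) ≡ ∑[ v < n ] g (inj₁ v) + edgeSum n (g ∘ inj₂)
  ∑-positions g = begin
    ∑[ k < ℓ ] g (to x k)                                  ≡⟨ ∑-permute (g ∘ to x) (↔-sym x ↔-∘ canonical n) ⟩
    ∑[ k < tri n ] g (to x (from x (to (canonical n) k)))  ≡⟨ sum-cong-≗ (cong g ∘ Inverse.strictlyInverseˡ x ∘ to (canonical n)) ⟩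
    ∑[ k < tri n ] g (to (canonical n) k)                  ≡⟨ ∑-canonical n g ⟩
    ∑[ v < n ] g (inj₁ v) + edgeSum n (g ∘ inj₂)           ∎
    where open ≡-Reasoning

  cost≡edgeSum : cost (K n) s ≡ edgeSum n (edgeCost (K n) s)
  cost≡edgeSum = begin
    cost (K n) s                                         ≡⟨ cong List.sum (map-tabulate id (posCost (K n) s ∘ to x)) ⟩
    List.sum (tabulate (posCost (K n) s ∘ to x))         ≡⟨ listSum-tabulate ℓ _ ⟩
    ∑[ k < ℓ ] posCost (K n) s (to x k)                  ≡⟨ ∑-positions (posCost (K n) s) ⟩
    ∑[ v < n ] 0 + edgeSum n (edgeCost (K n) s)          ≡⟨ cong (_+ edgeSum n (edgeCost (K n) s)) (sum-replicate-zero n) ⟩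
    edgeSum n (edgeCost (K n) s)                         ∎
    where open ≡-Reasoning

  cost+[1+n]*vertexPosSum : cost (K n) s + suc n * vertexPosSum ≡ 2 * ∑[ k < tri n ] toℕ k
  cost+[1+n]*vertexPosSum = begin
    cost (K n) s + suc n * A  ≡⟨ cong (_+ suc n * A) cost≡edgeSum ⟩
    c + (A + n * A)           ≡⟨ cong (λ m → c + (A + m)) (edgeSum-endpoints n (pos ∘ inj₁)) ⟨
    c + (A + (C + A))         ≡⟨ solve 3 (λ c a e → c :+ (a :+ (e :+ a)) := (c :+ e) :+ con 2 :* a) refl c A C ⟩
    (c + C) + 2 * A           ≡⟨ cong (_+ 2 * A) c+C≡2*B ⟩
    2 * B + 2 * A             ≡⟨ *-distribˡ-+ 2 B A ⟨
    2 * (B + A)               ≡⟨ cong (2 *_) (trans (+-comm B A) A+B≡∑toℕ) ⟩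
    2 * ∑[ k < ℓ ] toℕ k      ≡⟨ cong (λ m → 2 * ∑[ k < m ] toℕ k) tri≡length ⟨
    2 * ∑[ k < tri n ] toℕ k  ∎
    where
    open ≡-Reasoning
    A = vertexPosSum
    B = edgeSum n (pos ∘ inj₂)
    C = edgeSum n (λ e → pos (inj₁ (proj₁ e)) + pos (inj₁ (proj₁ (proj₂ e))))
    c = edgeSum n (edgeCost (K n) s)

    m∸u+m∸w+[u+w]≡2*m : ∀ {u w m} → u ≤ m → w ≤ m → (m ∸ u) + (m ∸ w) + (u + w) ≡ 2 * m
    m∸u+m∸w+[u+w]≡2*m {u} {w} {m} u≤m w≤m = begin
      (m ∸ u) + (m ∸ w) + (u + w)  ≡⟨ interchange (m ∸ u) (m ∸ w) u w ⟩
      (m ∸ u + u) + (m ∸ w + w)    ≡⟨ cong₂ _+_ (m∸n+n≡m u≤m) (m∸n+n≡m w≤m) ⟩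
      m + m                        ≡⟨ cong (m +_) (+-identityʳ m) ⟨
      2 * m                        ∎

    c+C≡2*B : c + C ≡ 2 * B
    c+C≡2*B = begin
      c + C                                                            ≡⟨ edgeSum-distrib-+ n _ _ ⟨
      edgeSum n (λ e → edgeCost (K n) s e + (pos (inj₁ (proj₁ e)) + pos (inj₁ (proj₁ (proj₂ e)))))
        ≡⟨ edgeSum-cong n (λ e → m∸u+m∸w+[u+w]≡2*m (<⇒≤ (proj₁ (valid e))) (<⇒≤ (proj₂ (valid e)))) ⟩
      edgeSum n (λ e → 2 * pos (inj₂ e))                               ≡⟨ *-distribˡ-edgeSum n 2 _ ⟨
      2 * B                                                            ∎

    A+B≡∑toℕ : A + B ≡ ∑[ k < ℓ ] toℕ k
    A+B≡∑toℕ = begin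
      A + B                  ≡⟨ ∑-positions pos ⟨
      ∑[ k < ℓ ] pos (to x k) ≡⟨ sum-cong-≗ (cong toℕ ∘ Inverse.strictlyInverseʳ x) ⟩
      ∑[ k < ℓ ] toℕ k       ∎

  verticesUpTo : ℕ → ℕ
  verticesUpTo t = ∑[ v < n ] 𝟙[ pos (inj₁ v) ≤ t ]

  -- The first t + 1 items are vertices counted by verticesUpTo t and edges between them.
  1+t≤tri[verticesUpTo] : ∀ {t} → t < ℓ → suc t ≤ tri (verticesUpTo t)
  1+t≤tri[verticesUpTo] {t} t<ℓ = begin
    suc t                                                    ≡⟨ trans (∑𝟙[≤]≡⊓ ℓ t) (m≥n⇒m⊓n≡n t<ℓ) ⟨
    ∑[ k < ℓ ] 𝟙[ toℕ k ≤ t ]                                ≡⟨ sum-cong-≗ (λ k → cong 𝟙[_≤ t ] (cong toℕ (Inverse.strictlyInverseʳ x k))) ⟨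
    ∑[ k < ℓ ] 𝟙[ pos (to x k) ≤ t ]                         ≡⟨ ∑-positions (λ y → 𝟙[ pos y ≤ t ]) ⟩
    a + edgeSum n (λ e → 𝟙[ pos (inj₂ e) ≤ t ])              ≤⟨ +-monoʳ-≤ a (edgeSum-mono-≤ n (λ e → 𝟙≤𝟙*𝟙 t (proj₁ (valid e)) (proj₂ (valid e)))) ⟩
    a + edgeSum n (λ e → b (proj₁ e) * b (proj₁ (proj₂ e)))  ≡⟨ +-comm a _ ⟩
    edgeSum n (λ e → b (proj₁ e) * b (proj₁ (proj₂ e))) + a  ≡⟨ edgeSum-inside n b (λ v → 𝟙≤1 (pos (inj₁ v)) t) ⟩
    tri a                                                    ∎
    where
    open ≤-Reasoning
    a = verticesUpTo t
    b : Fin n → ℕ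
    b v = 𝟙[ pos (inj₁ v) ≤ t ]

  verticesAfter-bound : ∀ {t} → t < ℓ →
    ∑[ v < n ] 𝟙[ suc t ≤ pos (inj₁ v) ] ≤ ∑[ j < n ] 𝟙[ suc t ≤ tri (toℕ j) ]
  verticesAfter-bound {t} t<ℓ = +-cancelˡ-≤ g c d (subst (g + c ≤_) complements (+-monoˡ-≤ c g≤a))
    where
    a = verticesUpTo t
    c = ∑[ v < n ] 𝟙[ suc t ≤ pos (inj₁ v) ]
    g = ∑[ j < n ] 𝟙[ tri (toℕ j) ≤ t ]
    d = ∑[ j < n ] 𝟙[ suc t ≤ tri (toℕ j) ]
    g≤a : g ≤ a
    g≤a = begin
      g                                    ≤⟨ ∑-mono-≤ {n} (λ j → 𝟙[tri≤]≤𝟙[<] {a = a} (toℕ j) (1+t≤tri[verticesUpTo] t<ℓ)) ⟩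
      ∑[ j < n ] 𝟙[ suc (toℕ j) ≤ a ]      ≡⟨ ∑𝟙[<]≡⊓ n a ⟩
      n ⊓ a                                ≤⟨ m⊓n≤n n a ⟩
      a                                    ∎
      where open ≤-Reasoning
    ∑-complement : (f : Fin n → ℕ) → ∑[ v < n ] 𝟙[ f v ≤ t ] + ∑[ v < n ] 𝟙[ suc t ≤ f v ] ≡ ∑[ v < n ] 1
    ∑-complement f = trans (sym (∑-distrib-+ (λ v → 𝟙[ f v ≤ t ]) (λ v → 𝟙[ suc t ≤ f v ])))
                           (sum-cong-≗ (λ v → 𝟙-complement (f v) t))
    complements : a + c ≡ g + d
    complements = trans (∑-complement (pos ∘ inj₁)) (sym (∑-complement (tri ∘ toℕ)))

  vertexPosSum≤tetra : vertexPosSum ≤ tetra n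
  vertexPosSum≤tetra = begin
    ∑[ v < n ] pos (inj₁ v)                                  ≡⟨ sum-cong-≗ (λ v → layers (<⇒≤ (toℕ<n (from x (inj₁ v))))) ⟨
    ∑[ v < n ] ∑[ t < ℓ ] 𝟙[ suc (toℕ t) ≤ pos (inj₁ v) ]    ≡⟨ ∑-comm {n} {ℓ} (λ v t → 𝟙[ suc (toℕ t) ≤ pos (inj₁ v) ]) ⟩
    ∑[ t < ℓ ] ∑[ v < n ] 𝟙[ suc (toℕ t) ≤ pos (inj₁ v) ]    ≤⟨ ∑-mono-≤ (λ t → verticesAfter-bound (toℕ<n t)) ⟩
    ∑[ t < ℓ ] ∑[ j < n ] 𝟙[ suc (toℕ t) ≤ tri (toℕ j) ]     ≡⟨ ∑-comm {n} {ℓ} (λ j t → 𝟙[ suc (toℕ t) ≤ tri (toℕ j) ]) ⟨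
    ∑[ j < n ] ∑[ t < ℓ ] 𝟙[ suc (toℕ t) ≤ tri (toℕ j) ]     ≡⟨ sum-cong-≗ (λ j → layers (tri[j]≤ℓ j)) ⟩
    tetra n                                                  ∎
    where
    open ≤-Reasoning
    layers : ∀ {p} → p ≤ ℓ → ∑[ t < ℓ ] 𝟙[ suc (toℕ t) ≤ p ] ≡ p
    layers {p} p≤ℓ = trans (∑𝟙[<]≡⊓ ℓ p) (m≥n⇒m⊓n≡n p≤ℓ)
    tri[j]≤ℓ : (j : Fin n) → tri (toℕ j) ≤ ℓ
    tri[j]≤ℓ j = subst (tri (toℕ j) ≤_) tri≡length (tri-mono-≤ (<⇒≤ (toℕ<n j)))

canonical-vertexPosSum : ∀ n → vertexPosSum (canonicalCSeq n) ≡ tetra n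
canonical-vertexPosSum n = sum-cong-≗ (canonical-vertexPos n)

-- The formula also holds for n = 0.
theorem8 : (n : ℕ) → 1 ≤ n →
    MinCost (K n) (((n Data.Nat.∸ 1) * n * (n + 1) * (n + 4)) / 12)
theorem8 n _ = (tri n , canonicalCSeq n , attained) , bounded
  where
  ν = ((n ∸ 1) * n * (n + 1) * (n + 4)) / 12
  Y = suc n * tetra n

  attained : cost (K n) (canonicalCSeq n) ≡ ν
  attained = +-cancelʳ-≡ Y _ _ (begin
    cost (K n) (canonicalCSeq n) + Y
      ≡⟨ cong (λ m → cost (K n) (canonicalCSeq n) + suc n * m) (canonical-vertexPosSum n) ⟨
    cost (K n) (canonicalCSeq n) + suc n * vertexPosSum (canonicalCSeq n)
      ≡⟨ cost+[1+n]*vertexPosSum (canonicalCSeq n) ⟩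
    2 * ∑[ k < tri n ] toℕ k
      ≡⟨ minCost-closedForm n ⟨
    ν + Y ∎)
    where open ≡-Reasoning

  bounded : ∀ ℓ (s : CSeq (K n) ℓ) → ν ≤ cost (K n) s
  bounded ℓ s = +-cancelʳ-≤ Y ν _ (begin
    ν + Y                                    ≡⟨ minCost-closedForm n ⟩
    2 * ∑[ k < tri n ] toℕ k                 ≡⟨ cost+[1+n]*vertexPosSum s ⟨
    cost (K n) s + suc n * vertexPosSum s    ≤⟨ +-monoʳ-≤ (cost (K n) s) (*-monoʳ-≤ (suc n) (vertexPosSum≤tetra s)) ⟩
    cost (K n) s + Y                         ∎)
    where open ≤-Reasoning
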